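{- Every Scott-closed irreducible subset of $\mathcal{H}$ is either of the form ${\downarrow}x$ for some $x\in\mathcal{H}$, or of the form ${\downarrow}L_s$ for some $s\in\mathbb{N}^*$, where $L_s=\{(m,s)\mid m\in\mathbb{N}\}$.
   Context: Let $\mathbb{N}^*$ be the set of finite strings of natural numbers; $\varepsilon$ is the empty string, $n{:}s$ is $s$ with $n$ put in front, $ts$ is concatenation, and for nonempty $t$, $\min(t)$ is its least entry. On $\mathbb{N}\times\mathbb{N}^*$ define, for $m,m',n,n'\in\mathbb{N}$, $s,t\in\mathbb{N}^*$: $(m,n{:}s)<_1(m,n'{:}s)$ if $n<n'$; $(m,ts)<_2(m,s)$ if $t\neq\varepsilon$; $(m,ts)<_3(m',s)$ if $t\ne\varepsilon$ and $\min(t)\le m'$. Let $<\;=\;<_1\cup<_2\cup<_3\cup(<_2;<_1)\cup(<_3;<_1)$ ($x\,(R;R')\,z$ iff $\exists y$, $x\,R\,y$, $y\,R'\,z$) and $\le\;=\;<\cup=$; $\mathcal{H}=(\mathbb{N}\times\mathbb{N}^*,\le)$, a dcpo. Irreducible means (with respect to the Scott topology) nonempty and, whenever contained in a union of two Scott-closed sets, contained in one of them. -}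

module Defs where

open import Data.Nat using (ℕ; _<_; _≤_; _⊓_)
open import Data.List using (List; []; _∷_; _++_; foldr)
open import Data.Product using (Σ; ∃; ∃-syntax; _×_; _,_; proj₁; proj₂)
open import Data.Sum using (_⊎_)
open import Relation.Binary.PropositionalEquality using (_≡_)
open import Relation.Nullary using (Dec)

ℍ : Set
ℍ = ℕ × List ℕ

minStr : ℕ → List ℕ → ℕ
minStr k t = foldr _⊓_ k t

_<₁_ : ℍ → ℍ → Set
x <₁ y = ∃[ m ] ∃[ n ] ∃[ n' ] ∃[ s ]
  (x ≡ (m , n ∷ s)) × (y ≡ (m , n' ∷ s)) × (n < n')

-- (m , t s) <₂ (m , s)  if t ≠ ε   (t written k ∷ t')
_<₂_ : ℍ → ℍ → Set
x <₂ y = ∃[ m ] ∃[ k ] ∃[ t' ] ∃[ s ]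
  (x ≡ (m , (k ∷ t') ++ s)) × (y ≡ (m , s))

_<₃_ : ℍ → ℍ → Set
x <₃ y = ∃[ m ] ∃[ m' ] ∃[ k ] ∃[ t' ] ∃[ s ]
  (x ≡ (m , (k ∷ t') ++ s)) × (y ≡ (m' , s)) × (minStr k t' ≤ m')

_⨾_ : (ℍ → ℍ → Set) → (ℍ → ℍ → Set) → ℍ → ℍ → Set
(R ⨾ R') x z = ∃[ y ] (R x y × R' y z)

_⊏_ : ℍ → ℍ → Set
x ⊏ y = (x <₁ y) ⊎ (x <₂ y) ⊎ (x <₃ y) ⊎ ((_<₂_ ⨾ _<₁_) x y) ⊎ ((_<₃_ ⨾ _<₁_) x y)

_⊑_ : ℍ → ℍ → Set
x ⊑ y = (x ⊏ y) ⊎ (x ≡ y)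

Subset : Set₁
Subset = ℍ → Set

_⊆_ : Subset → Subset → Set
A ⊆ B = ∀ x → A x → B x

_≐_ : Subset → Subset → Set
A ≐ B = (A ⊆ B) × (B ⊆ A)

_∪_ : Subset → Subset → Subset
(A ∪ B) x = A x ⊎ B x

Nonempty : Subset → Set
Nonempty A = ∃[ x ] A x

IsUpperBound : Subset → ℍ → Set
IsUpperBound D u = ∀ x → D x → x ⊑ u

IsSup : Subset → ℍ → Set
IsSup D u = IsUpperBound D u × (∀ v → IsUpperBound D v → u ⊑ v)

Directed : Subset → Set
Directed D = Nonempty D × (∀ x y → D x → D y → ∃[ z ] (D z × x ⊑ z × y ⊑ z))

IsLower : Subset → Set
IsLower C = ∀ x y → x ⊑ y → C y → C x

ScottClosed : Subset → Set₁
ScottClosed C = IsLower C × (∀ D u → Directed D → D ⊆ C → IsSup D u → C u)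

Irreducible : Subset → Set₁
Irreducible C = Nonempty C ×
  (∀ A B → ScottClosed A → ScottClosed B → C ⊆ (A ∪ B) → (C ⊆ A) ⊎ (C ⊆ B))

↓_ : ℍ → Subset
(↓ x) y = y ⊑ x

↓L : List ℕ → Subset
↓L s y = ∃[ m ] (y ⊑ (m , s))

-- classical logic (the paper's ambient logic)
ExcludedMiddle : Set₁
ExcludedMiddle = (P : Set) → Dec P

-- Going up in ℋ never lengthens the string, and between strings of equal
-- length it only raises the head at a fixed level.  Hence a directed set
-- either has a greatest element or is cofinal in a chain (m , N ∷ s), N ∈ ℕ,
-- whose supremum is (m , s): a lower set is Scott-closed iff it is closed
-- under the suprema of these chains.  In a Scott-closed C every element lies
-- below a maximal one (make the string as short as possible, then the head as
-- large as possible).  If some maximal z has L_s ⊄ C for its string s, then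
-- C ⊆ ↓z ∪ Ψ with Ψ the down-closure of the other maximal elements and of the
-- lines L_t ⊆ C, and z ∉ Ψ, so irreducibility gives C = ↓z.  Otherwise the
-- maximal elements come in whole lines inside C, and splitting off the
-- maximal elements with a different string gives C = ↓L_s.

module Submission where

open import Defs
open import Data.Empty using (⊥-elim)
open import Data.List using (List; []; _∷_; _++_; length; head)
open import Data.List.Properties using (++-assoc; length-++; foldr-preservesᵒ)
open import Data.List.Relation.Unary.Any using (Any; here; there)
open import Data.List.Relation.Unary.Any.Properties using (++⁺ˡ; ++⁺ʳ)
open import Data.List.Membership.Propositional using (lose)
open import Data.List.Membership.Propositional.Properties using (foldr-selective)
open import Data.Maybe using (fromMaybe)
open import Data.Nat using (ℕ; zero; suc; _<_; _≤_; _⊓_; _⊔_; _+_; z≤n; s≤s; s≤s⁻¹)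
open import Data.Nat.Induction using (<-rec)
open import Data.Nat.Properties
open import Data.Product using (∃-syntax; _×_; _,_; proj₁; proj₂)
open import Data.Sum using (_⊎_; inj₁; inj₂; [_,_]; map₂)
open import Function using (_∘_)
open import Relation.Nullary using (¬_; yes; no)
open import Relation.Binary.PropositionalEquality
  using (_≡_; _≢_; refl; sym; cong; subst)

infix 4 _≼_ _≲_

data _≼_ : List ℕ → List ℕ → Set where
  []≼[] : [] ≼ []
  ∷≼∷   : ∀ {n n' r} → n ≤ n' → n ∷ r ≼ n' ∷ r

≼-refl : ∀ {w} → w ≼ w
≼-refl {[]}    = []≼[]
≼-refl {_ ∷ _} = ∷≼∷ ≤-refl

≼-trans : ∀ {u v w} → u ≼ v → v ≼ w → u ≼ w
≼-trans []≼[]   []≼[]   = []≼[]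
≼-trans (∷≼∷ p) (∷≼∷ q) = ∷≼∷ (≤-trans p q)

≼-antisym : ∀ {u v} → u ≼ v → v ≼ u → u ≡ v
≼-antisym []≼[]   []≼[]   = refl
≼-antisym (∷≼∷ p) (∷≼∷ q) = cong (_∷ _) (≤-antisym p q)

≼⇒length≡ : ∀ {u v} → u ≼ v → length u ≡ length v
≼⇒length≡ []≼[]   = refl
≼⇒length≡ (∷≼∷ _) = refl

≼-++⁻ : ∀ {w k} t w' → w ≼ (k ∷ t) ++ w' → ∃[ k' ] (k' ≤ k × w ≡ (k' ∷ t) ++ w')
≼-++⁻ t w' (∷≼∷ {n} p) = n , p , refl

≼⇒≡⊎<-head : ∀ {w v} → w ≼ v →
  w ≡ v ⊎ ∃[ n ] ∃[ n' ] ∃[ r ] (w ≡ n ∷ r × v ≡ n' ∷ r × n < n')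
≼⇒≡⊎<-head []≼[] = inj₁ refl
≼⇒≡⊎<-head (∷≼∷ {n} {n'} {r} n≤n') with m≤n⇒m<n∨m≡n n≤n'
... | inj₁ n<n' = inj₂ (n , n' , r , refl , refl , n<n')
... | inj₂ refl = inj₁ refl

Any≤-head : ∀ {b k k' t} → k' ≤ k → Any (_≤ b) (k ∷ t) → Any (_≤ b) (k' ∷ t)
Any≤-head k'≤k (here k≤b) = here (≤-trans k'≤k k≤b)
Any≤-head _    (there p)  = there p

minStr≤⇒Any≤ : ∀ {b} k t → minStr k t ≤ b → Any (_≤ b) (k ∷ t)
minStr≤⇒Any≤ {b} k t p with foldr-selective ⊓-sel k t
... | inj₁ min≡k = here (subst (_≤ b) min≡k p)
... | inj₂ min∈t = there (lose min∈t p)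

⊓-≤-either : ∀ {b} x y → x ≤ b ⊎ y ≤ b → x ⊓ y ≤ b
⊓-≤-either x y = [ m≤n⇒m⊓o≤n y , m≤n⇒o⊓m≤n x ]

Any≤⇒minStr≤ : ∀ {b} k t → Any (_≤ b) (k ∷ t) → minStr k t ≤ b
Any≤⇒minStr≤ k t (here p)  = foldr-preservesᵒ ⊓-≤-either k t (inj₁ p)
Any≤⇒minStr≤ k t (there p) = foldr-preservesᵒ ⊓-≤-either k t (inj₂ p)

-- ⊑ in normal form: raise the head at the same level, or drop a nonempty
-- prefix k ∷ t and raise the head of what remains; the level may change
-- only if some entry of k ∷ t is at most the new level.
data _≲_ : ℍ → ℍ → Set where
  ≲-level : ∀ {m w v} → w ≼ v → (m , w) ≲ (m , v)
  ≲-drop  : ∀ {m m' w v} k t w' → w ≡ (k ∷ t) ++ w' → w' ≼ v →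
            m ≡ m' ⊎ Any (_≤ m') (k ∷ t) → (m , w) ≲ (m' , v)

≲-refl : ∀ {x} → x ≲ x
≲-refl = ≲-level ≼-refl

≲-trans : ∀ {x y z} → x ≲ y → y ≲ z → x ≲ z
≲-trans (≲-level p) (≲-level q) = ≲-level (≼-trans p q)
≲-trans (≲-level p) (≲-drop k t w' refl q c) with ≼-++⁻ t w' p
... | k' , k'≤k , refl = ≲-drop k' t w' refl q (map₂ (Any≤-head k'≤k) c)
≲-trans (≲-drop k t w' e p c) (≲-level q) = ≲-drop k t w' e (≼-trans p q) c
≲-trans {m , _} {m' , _} {m'' , _} (≲-drop k t w' refl p c) (≲-drop k₂ t₂ v' refl q c₂)
  with ≼-++⁻ t₂ v' p
... | k' , k'≤k₂ , refl =
  ≲-drop k (t ++ k' ∷ t₂) v' (cong (k ∷_) (sym (++-assoc t (k' ∷ t₂) v'))) q (compose c c₂)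
  where
  compose : m ≡ m' ⊎ Any (_≤ m') (k ∷ t) → m' ≡ m'' ⊎ Any (_≤ m'') (k₂ ∷ t₂) →
            m ≡ m'' ⊎ Any (_≤ m'') (k ∷ t ++ k' ∷ t₂)
  compose (inj₁ refl) (inj₁ refl) = inj₁ refl
  compose (inj₂ low)  (inj₁ refl) = inj₂ (++⁺ˡ low)
  compose _           (inj₂ low)  = inj₂ (++⁺ʳ (k ∷ t) (Any≤-head k'≤k₂ low))

⊑⇒≲ : ∀ {x y} → x ⊑ y → x ≲ y
⊑⇒≲ (inj₂ refl) = ≲-refl
⊑⇒≲ (inj₁ (inj₁ (_ , _ , _ , _ , refl , refl , n<n'))) = ≲-level (∷≼∷ (<⇒≤ n<n'))
⊑⇒≲ (inj₁ (inj₂ (inj₁ (_ , k , t , s , refl , refl)))) = ≲-drop k t s refl ≼-refl (inj₁ refl)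
⊑⇒≲ (inj₁ (inj₂ (inj₂ (inj₁ (_ , _ , k , t , s , refl , refl , low))))) =
  ≲-drop k t s refl ≼-refl (inj₂ (minStr≤⇒Any≤ k t low))
⊑⇒≲ (inj₁ (inj₂ (inj₂ (inj₂ (inj₁
      (_ , (_ , k , t , _ , refl , refl) , (_ , n , _ , s , refl , refl , n<n'))))))) =
  ≲-drop k t (n ∷ s) refl (∷≼∷ (<⇒≤ n<n')) (inj₁ refl)
⊑⇒≲ (inj₁ (inj₂ (inj₂ (inj₂ (inj₂
      (_ , (_ , _ , k , t , _ , refl , refl , low) , (_ , n , _ , s , refl , refl , n<n'))))))) =
  ≲-drop k t (n ∷ s) refl (∷≼∷ (<⇒≤ n<n')) (inj₂ (minStr≤⇒Any≤ k t low))

≲⇒⊑ : ∀ {x y} → x ≲ y → x ⊑ y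
≲⇒⊑ {m , _} (≲-level p) with ≼⇒≡⊎<-head p
... | inj₁ refl = inj₂ refl
... | inj₂ (n , n' , r , refl , refl , n<n') = inj₁ (inj₁ (m , n , n' , r , refl , refl , n<n'))
≲⇒⊑ {m , _} {m' , _} (≲-drop k t w' refl p c) with ≼⇒≡⊎<-head p | c
... | inj₁ refl | inj₁ refl = inj₁ (inj₂ (inj₁ (m , k , t , w' , refl , refl)))
... | inj₁ refl | inj₂ low  =
  inj₁ (inj₂ (inj₂ (inj₁ (m , m' , k , t , w' , refl , refl , Any≤⇒minStr≤ k t low))))
... | inj₂ (n , n' , r , refl , refl , n<n') | inj₁ refl =
  inj₁ (inj₂ (inj₂ (inj₂ (inj₁
    ((m , n ∷ r) , (m , k , t , n ∷ r , refl , refl) , (m , n , n' , r , refl , refl , n<n'))))))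
... | inj₂ (n , n' , r , refl , refl , n<n') | inj₂ low =
  inj₁ (inj₂ (inj₂ (inj₂ (inj₂
    ((m' , n ∷ r) , (m , m' , k , t , n ∷ r , refl , refl , Any≤⇒minStr≤ k t low)
                  , (m' , n , n' , r , refl , refl , n<n'))))))

drop-length< : ∀ k t {w' v} → w' ≼ v → length v < length ((k ∷ t) ++ w')
drop-length< k t {w'} {v} p rewrite length-++ t {w'} | ≼⇒length≡ p =
  s≤s (m≤n+m (length v) (length t))

≲-length : ∀ {m m' w v} → (m , w) ≲ (m' , v) → length v ≤ length w
≲-length (≲-level p)              = ≤-reflexive (sym (≼⇒length≡ p))
≲-length (≲-drop k t _ refl p _) = <⇒≤ (drop-length< k t p)

≲-equal-length : ∀ {m m' w v} → (m , w) ≲ (m' , v) → length w ≡ length v → m ≡ m' × w ≼ v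
≲-equal-length (≲-level p)              _ = refl , p
≲-equal-length (≲-drop k t _ refl p _) e = ⊥-elim (<-irrefl (sym e) (drop-length< k t p))

≲-squeeze : ∀ {m m' c s w} → (m , s) ≲ (c , w) → (c , w) ≲ (m' , s) → (c , w) ≡ (m , s)
≲-squeeze p q with ≲-equal-length p (≤-antisym (≲-length q) (≲-length p))
... | refl , s≼w with ≲-equal-length q (≤-antisym (≲-length p) (≲-length q))
...   | _ , w≼s = cong (_ ,_) (≼-antisym w≼s s≼w)

≲-antisym : ∀ {x y} → x ≲ y → y ≲ x → x ≡ y
≲-antisym p q = sym (≲-squeeze p q)

≲-relevel : ∀ {m m' w v} c → (m , w) ≲ (m' , v) → (c , w) ≲ (c , v)
≲-relevel c (≲-level p)              = ≲-level p
≲-relevel c (≲-drop k t w' e p _)   = ≲-drop k t w' e p (inj₁ refl)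

[]-top : ∀ {b y} → (b , []) ≲ y → y ≡ (b , [])
[]-top (≲-level []≼[])          = refl
[]-top (≲-drop _ _ _ () _ _)

cons≲ : ∀ {m m'} N s → m ≡ m' ⊎ N ≤ m' → (m , N ∷ s) ≲ (m' , s)
cons≲ N s c = ≲-drop N [] s refl ≼-refl (map₂ here c)

≲-cons⁻ : ∀ {m N s b v} → (m , N ∷ s) ≲ (b , v) →
  (m , s) ≲ (b , v) ⊎ (N ≤ b × (m , s) ≲ (m , v)) ⊎ (m ≡ b × ∃[ N' ] (N ≤ N' × v ≡ N' ∷ s))
≲-cons⁻ (≲-level (∷≼∷ {n' = N'} p))                   = inj₂ (inj₂ (refl , N' , p , refl))
≲-cons⁻ (≲-drop _ []      _ refl p (inj₁ refl))       = inj₁ (≲-level p)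
≲-cons⁻ (≲-drop _ []      _ refl p (inj₂ (here N≤b))) = inj₂ (inj₁ (N≤b , ≲-level p))
≲-cons⁻ (≲-drop _ (x ∷ t) w' refl p (inj₁ refl))       = inj₁ (≲-drop x t w' refl p (inj₁ refl))
≲-cons⁻ (≲-drop _ (x ∷ t) w' refl p (inj₂ (here N≤b))) =
  inj₂ (inj₁ (N≤b , ≲-drop x t w' refl p (inj₁ refl)))
≲-cons⁻ (≲-drop _ (x ∷ t) w' refl p (inj₂ (there low))) = inj₁ (≲-drop x t w' refl p (inj₂ low))

cons-chain-lub : ∀ {m s y} → (∀ N → (m , N ∷ s) ≲ y) → (m , s) ≲ y
cons-chain-lub {y = b , v} above with ≲-cons⁻ (above (suc (b + fromMaybe 0 (head v))))
... | inj₁ p                           = p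
... | inj₂ (inj₁ (N≤b , _))            = ⊥-elim (≤⇒≯ (m≤m+n b _) N≤b)
... | inj₂ (inj₂ (refl , N' , N≤N' , refl)) = ⊥-elim (≤⇒≯ (m≤n+m N' b) N≤N')

cons-chain-isSup : ∀ m s → IsSup (λ y → ∃[ N ] (y ≡ (m , N ∷ s))) (m , s)
cons-chain-isSup m s =
  (λ { _ (N , refl) → ≲⇒⊑ (cons≲ N s (inj₁ refl)) }) ,
  (λ v ub → ≲⇒⊑ (cons-chain-lub (λ N → ⊑⇒≲ (ub _ (N , refl)))))

LowerSet : Subset → Set
LowerSet F = ∀ {x y} → x ≲ y → F y → F x

ChainClosed : Subset → Set
ChainClosed F = ∀ m s → (∀ N → F (m , N ∷ s)) → F (m , s)

ScottClosed⇒LowerSet : ∀ {F} → ScottClosed F → LowerSet F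
ScottClosed⇒LowerSet (lower , _) x≲y = lower _ _ (≲⇒⊑ x≲y)

ScottClosed⇒ChainClosed : ∀ {F} → ScottClosed F → ChainClosed F
ScottClosed⇒ChainClosed (_ , closed) m s chain =
  closed _ (m , s) directed (λ { _ (N , refl) → chain N }) (cons-chain-isSup m s)
  where
  directed : Directed (λ y → ∃[ N ] (y ≡ (m , N ∷ s)))
  directed = (_ , 0 , refl) , λ { _ _ (N₁ , refl) (N₂ , refl) →
    (m , N₁ ⊔ N₂ ∷ s) , (N₁ ⊔ N₂ , refl) ,
    ≲⇒⊑ (≲-level (∷≼∷ (m≤m⊔n N₁ N₂))) , ≲⇒⊑ (≲-level (∷≼∷ (m≤n⊔m N₁ N₂))) }

IsSup-unique : ∀ {D u u'} → IsSup D u → IsSup D u' → u ≡ u'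
IsSup-unique (ub , least) (ub' , least') =
  ≲-antisym (⊑⇒≲ (least _ ub')) (⊑⇒≲ (least' _ ub))

greatest-isSup : ∀ {D g} → D g → (∀ d → D d → d ≲ g) → IsSup D g
greatest-isSup Dg below = (λ d Dd → ≲⇒⊑ (below d Dd)) , (λ v ub → ub _ Dg)

minimal-length-cofinal : ∀ {D a w₀} → Directed D → D (a , w₀) →
  (∀ {d} → D d → length w₀ ≤ length (proj₂ d)) →
  ∀ {d} → D d → ∃[ v ] (D (a , v) × d ≲ (a , v) × w₀ ≼ v)
minimal-length-cofinal (_ , directed) Dd₀ shortest {d} Dd
  with directed d _ Dd Dd₀
... | (_ , v) , De , d⊑e , d₀⊑e
  with ≲-equal-length (⊑⇒≲ d₀⊑e) (≤-antisym (shortest De) (≲-length (⊑⇒≲ d₀⊑e)))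
...   | refl , w₀≼v = v , De , ⊑⇒≲ d⊑e , w₀≼v

line-cofinal : ∀ {D a h₀ r} → Directed D → D (a , h₀ ∷ r) →
  (∀ {d} → D d → suc (length r) ≤ length (proj₂ d)) →
  ∀ {d} → D d → ∃[ h ] (D (a , h ∷ r) × d ≲ (a , h ∷ r))
line-cofinal dir Dd₀ shortest Dd with minimal-length-cofinal dir Dd₀ shortest Dd
... | _ , De , d≲e , ∷≼∷ _ = _ , De , d≲e

cofinal-line-isSup : ∀ {D a r} → (∀ N → ∃[ h ] (N ≤ h × D (a , h ∷ r))) →
  (∀ {d} → D d → ∃[ h ] (D (a , h ∷ r) × d ≲ (a , h ∷ r))) → IsSup D (a , r)
cofinal-line-isSup {D} {a} {r} unbounded cofinal = ub , least
  where
  ub : IsUpperBound D (a , r)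
  ub _ Dd = let (h , _ , d≲h) = cofinal Dd in ≲⇒⊑ (≲-trans d≲h (cons≲ h r (inj₁ refl)))
  least : ∀ v → IsUpperBound D v → (a , r) ⊑ v
  least _ ubv = ≲⇒⊑ (cons-chain-lub λ N →
    let (h , N≤h , Dh) = unbounded N in ≲-trans (≲-level (∷≼∷ N≤h)) (⊑⇒≲ (ubv _ Dh)))

module Classical (em : ExcludedMiddle) where

  dne : ∀ {P : Set} → ¬ ¬ P → P
  dne {P} ¬¬p with em P
  ... | yes p = p
  ... | no ¬p = ⊥-elim (¬¬p ¬p)

  least-by : ∀ {A : Set} (f : A → ℕ) {P : A → Set} {a} → P a →
    ∃[ b ] (P b × ∀ {c} → P c → f b ≤ f c)
  least-by f {P} {a} pa = <-rec Goal step (f a) pa refl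
    where
    Goal : ℕ → Set
    Goal n = ∀ {a} → P a → f a ≡ n → ∃[ b ] (P b × ∀ {c} → P c → f b ≤ f c)
    step : ∀ n → (∀ {n'} → n' < n → Goal n') → Goal n
    step _ smaller {a} pa refl with em (∃[ c ] (P c × f c < f a))
    ... | yes (c , pc , fc<fa) = smaller fc<fa pc refl
    ... | no none = a , pa , λ {c} pc → ≮⇒≥ (λ fc<fa → none (c , pc , fc<fa))

  max-below : ∀ {P : ℕ → Set} t {h} → P h → (∀ {h'} → P h' → h' ≤ t) →
    ∃[ k ] (P k × ∀ {h'} → P h' → h' ≤ k)
  max-below {P} t ph bound with em (P t)
  ... | yes pt = t , pt , bound
  max-below zero    ph bound | no ¬pt with bound ph
  ... | z≤n = ⊥-elim (¬pt ph)
  max-below (suc t) ph bound | no ¬pt =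
    max-below t ph (λ ph' → s≤s⁻¹ (≤∧≢⇒< (bound ph') (λ { refl → ¬pt ph' })))

  unbounded-or-max : ∀ {P : ℕ → Set} {h} → P h →
    (∀ N → ∃[ h' ] (N ≤ h' × P h')) ⊎ ∃[ k ] (P k × ∀ {h'} → P h' → h' ≤ k)
  unbounded-or-max {P} ph with em (∃[ N ] ¬ (∃[ h' ] (N ≤ h' × P h')))
  ... | no bounded = inj₁ (λ N → dne (λ none → bounded (N , none)))
  ... | yes (N , none) = inj₂ (max-below N ph (λ {h'} ph' →
          <⇒≤ (≰⇒> (λ N≤h' → none (h' , N≤h' , ph')))))

module _ (em : ExcludedMiddle) where
  open Classical em

  directed-sup-attained-or-approached : ∀ {D m s} → Directed D → IsSup D (m , s) →
    D (m , s) ⊎ (∀ N → ∃[ d ] (D d × (m , N ∷ s) ≲ d))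
  directed-sup-attained-or-approached {D} dir sup
    with least-by (length ∘ proj₂) {P = D} (proj₂ (proj₁ dir))
  ... | (a , []) , Dd₀ , shortest =
    inj₁ (subst D (IsSup-unique (greatest-isSup Dd₀ below) sup) Dd₀)
    where
    below : ∀ d → D d → d ≲ (a , [])
    below d Dd with minimal-length-cofinal dir Dd₀ shortest Dd
    ... | _ , _ , d≲e , []≼[] = d≲e
  ... | (a , _ ∷ r) , Dd₀ , shortest with unbounded-or-max {P = λ h → D (a , h ∷ r)} Dd₀
  ...   | inj₂ (k , Dk , bound) =
    inj₁ (subst D (IsSup-unique (greatest-isSup Dk below-k) sup) Dk)
    where
    below-k : ∀ d → D d → d ≲ (a , k ∷ r)
    below-k d Dd =
      let (_ , Dh , d≲h) = line-cofinal dir Dd₀ shortest Dd in ≲-trans d≲h (≲-level (∷≼∷ (bound Dh)))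
  ...   | inj₁ unbounded
    with IsSup-unique (cofinal-line-isSup unbounded (line-cofinal dir Dd₀ shortest)) sup
  ...     | refl = inj₂ λ N →
    let (h , N≤h , Dh) = unbounded N in (a , h ∷ r) , Dh , ≲-level (∷≼∷ N≤h)

  LowerSet∧ChainClosed⇒ScottClosed : ∀ {F} → LowerSet F → ChainClosed F → ScottClosed F
  LowerSet∧ChainClosed⇒ScottClosed {F} lower chain = (λ _ _ x⊑y → lower (⊑⇒≲ x⊑y)) , closed
    where
    closed : ∀ D u → Directed D → D ⊆ F → IsSup D u → F u
    closed D (m , s) dir D⊆F sup with directed-sup-attained-or-approached dir sup
    ... | inj₁ Du       = D⊆F _ Du
    ... | inj₂ approach = chain m s λ N →
      let (d , Dd , l) = approach N in lower l (D⊆F d Dd)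

↓-lower : ∀ x → LowerSet (↓ x)
↓-lower x y≲z z⊑x = ≲⇒⊑ (≲-trans y≲z (⊑⇒≲ z⊑x))

↓L-lower : ∀ s → LowerSet (↓L s)
↓L-lower s y≲z (k , z⊑ks) = k , ≲⇒⊑ (≲-trans y≲z (⊑⇒≲ z⊑ks))

↓-scottClosed : ExcludedMiddle → ∀ x → ScottClosed (↓ x)
↓-scottClosed em x = LowerSet∧ChainClosed⇒ScottClosed em (↓-lower x)
  (λ m s chain → ≲⇒⊑ (cons-chain-lub (λ N → ⊑⇒≲ (chain N))))

↓L-scottClosed : ExcludedMiddle → ∀ s → ScottClosed (↓L s)
↓L-scottClosed em s = LowerSet∧ChainClosed⇒ScottClosed em (↓L-lower s) closed
  where
  closed : ChainClosed (↓L s)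
  closed m s' chain with chain (suc (fromMaybe 0 (head s)))
  ... | k , l with ≲-cons⁻ (⊑⇒≲ l)
  ...   | inj₁ p                             = k , ≲⇒⊑ p
  ...   | inj₂ (inj₁ (_ , p))                = m , ≲⇒⊑ p
  ...   | inj₂ (inj₂ (refl , _ , N≤N' , refl)) = ⊥-elim (1+n≰n N≤N')

irreducible-split : ∀ {C A B x} → Irreducible C → ScottClosed A → ScottClosed B →
  C ⊆ (A ∪ B) → C x → ¬ B x → C ⊆ A
irreducible-split (_ , irreducible) scA scB cover Cx ¬Bx with irreducible _ _ scA scB cover
... | inj₁ C⊆A = C⊆A
... | inj₂ C⊆B = ⊥-elim (¬Bx (C⊆B _ Cx))

Maximal : Subset → ℍ → Set
Maximal C z = C z × (∀ {y} → C y → z ≲ y → y ≡ z)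

LineIn : Subset → List ℕ → Set
LineIn C s = ∀ m → C (m , s)

↓Maximal : Subset → (ℍ → Set) → Subset
↓Maximal C P y = ∃[ g ] (Maximal C g × P g × y ≲ g)

↓Maximal-lower : ∀ {C P} → LowerSet (↓Maximal C P)
↓Maximal-lower y≲z (g , max , Pg , z≲g) = g , max , Pg , ≲-trans y≲z z≲g

maximal⇒¬C-suc-head : ∀ {C m N s} → Maximal C (m , N ∷ s) → ¬ C (m , suc N ∷ s)
maximal⇒¬C-suc-head (_ , maximal) C-suc with maximal C-suc (≲-level (∷≼∷ (n≤1+n _)))
... | ()

module _ (em : ExcludedMiddle) {C : Subset} (scC : ScottClosed C) where
  open Classical em

  private
    lower : LowerSet C
    lower = ScottClosed⇒LowerSet scC

    chain : ChainClosed C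
    chain = ScottClosed⇒ChainClosed scC

  maximal-above : ∀ {x} → C x → ∃[ z ] (Maximal C z × x ≲ z)
  maximal-above {x} Cx with least-by (length ∘ proj₂) {P = λ y → C y × x ≲ y} (Cx , ≲-refl)
  ... | (b , []) , (Cy , x≲y) , _ = (b , []) , (Cy , λ _ → []-top) , x≲y
  ... | (b , h ∷ r) , (Cy , x≲y) , shortest with unbounded-or-max {P = λ h → C (b , h ∷ r)} Cy
  ...   | inj₁ unbounded = ⊥-elim (1+n≰n (shortest (Cbr , ≲-trans x≲y (cons≲ h r (inj₁ refl)))))
    where
    Cbr : C (b , r)
    Cbr = chain b r λ N →
      let (h' , N≤h' , Ch') = unbounded N in lower (≲-level (∷≼∷ N≤h')) Ch'
  ...   | inj₂ (k , Ck , bound) = (b , k ∷ r) , (Ck , maximal) , x≲z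
    where
    x≲z : x ≲ (b , k ∷ r)
    x≲z = ≲-trans x≲y (≲-level (∷≼∷ (bound Cy)))
    maximal : ∀ {y} → C y → (b , k ∷ r) ≲ y → y ≡ (b , k ∷ r)
    maximal Cy' z≲y
      with ≲-equal-length z≲y (≤-antisym (shortest (Cy' , ≲-trans x≲z z≲y)) (≲-length z≲y))
    ... | refl , ∷≼∷ k≤h' = cong (λ h' → (b , h' ∷ r)) (≤-antisym (bound Cy') k≤h')

  LineIn-of-unbounded : ∀ {s} → (∀ M → ∃[ b ] (M ≤ b × C (b , s))) → LineIn C s
  LineIn-of-unbounded {s} unbounded k = chain k s λ N →
    let (b , N≤b , Cb) = unbounded N in lower (cons≲ N s (inj₂ N≤b)) Cb

  LineIn-of-cons : ∀ {s} → (∀ N → ∃[ b ] (N ≤ b × C (b , s)) ⊎ LineIn C (N ∷ s)) → LineIn C s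
  LineIn-of-cons {s} cover with em (∃[ M ] ¬ (∃[ b ] (M ≤ b × C (b , s))))
  ... | no bounded = LineIn-of-unbounded (λ M → dne (λ none → bounded (M , none)))
  ... | yes (M , none) = λ k → chain k s (λ N → line N k)
    where
    line : ∀ N → LineIn C (N ∷ s)
    line N with cover (M + N)
    ... | inj₁ (b , M+N≤b , Cb) = ⊥-elim (none (b , ≤-trans (m≤m+n M N) M+N≤b , Cb))
    ... | inj₂ line-M+N = λ k → lower (≲-level (∷≼∷ (m≤n+m N M))) (line-M+N k)

  ↓Maximal⊆C : ∀ {P} → ↓Maximal C P ⊆ C
  ↓Maximal⊆C _ (_ , max , _ , y≲g) = lower y≲g (proj₁ max)

  maximal-cover : ∀ {A P} → LowerSet A → (∀ {g} → Maximal C g → A g ⊎ P g) →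
    C ⊆ (A ∪ ↓Maximal C P)
  maximal-cover lowerA split x Cx with maximal-above Cx
  ... | g , max , x≲g with split max
  ...   | inj₁ Ag = inj₁ (lowerA x≲g Ag)
  ...   | inj₂ Pg = inj₂ (g , max , Pg , x≲g)

  maximal-relevel : (∀ {z} → Maximal C z → LineIn C (proj₂ z)) →
    ∀ {m s} → Maximal C (m , s) → ∀ b → Maximal C (b , s)
  maximal-relevel lines {m} max b = lines max b , maximal
    where
    maximal : ∀ {y} → C y → (b , _) ≲ y → y ≡ (b , _)
    maximal Cy bs≲y with maximal-above Cy
    ... | (m' , _) , max' , y≲z'
      with proj₂ max (lines max' m) (≲-relevel m (≲-trans bs≲y y≲z'))
    ...   | refl = ≲-squeeze bs≲y y≲z'

  ≐↓L-of-maximal-lines : Irreducible C → (∀ {z} → Maximal C z → LineIn C (proj₂ z)) →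
    ∀ {m s} → Maximal C (m , s) → C ≐ ↓L s
  ≐↓L-of-maximal-lines irreducible lines {m} {s} max = C⊆↓L , ↓L⊆C
    where
    B : Subset
    B = ↓Maximal C (λ g → proj₂ g ≢ s)

    B-chainClosed : ChainClosed B
    B-chainClosed m' s' chainB with chainB 0
    ... | (b , v) , maxg , v≢s , l with ≲-cons⁻ l
    ...   | inj₁ p              = (b , v) , maxg , v≢s , p
    ...   | inj₂ (inj₁ (_ , p)) = (m' , v) , maximal-relevel lines maxg m' , v≢s , p
    ...   | inj₂ (inj₂ (refl , N' , _ , refl)) =
      ⊥-elim (maximal⇒¬C-suc-head maxg (↓Maximal⊆C _ (chainB (suc N'))))

    split : ∀ {g} → Maximal C g → ↓L s g ⊎ proj₂ g ≢ s
    split {b , v} _ with em (v ≡ s)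
    ... | yes v≡s = inj₁ (b , inj₂ (cong (b ,_) v≡s))
    ... | no v≢s  = inj₂ v≢s

    ¬B : ¬ B (m , s)
    ¬B (_ , maxg , g≢s , z≲g) = g≢s (cong proj₂ (proj₂ max (proj₁ maxg) z≲g))

    C⊆↓L : C ⊆ ↓L s
    C⊆↓L = irreducible-split irreducible (↓L-scottClosed em s)
      (LowerSet∧ChainClosed⇒ScottClosed em ↓Maximal-lower B-chainClosed)
      (maximal-cover (↓L-lower s) split) (proj₁ max) ¬B

    ↓L⊆C : ↓L s ⊆ C
    ↓L⊆C _ (k , y⊑ks) = lower (⊑⇒≲ y⊑ks) (lines max k)

  ≐↓-of-maximal : Irreducible C → ∀ {z} → Maximal C z → ¬ LineIn C (proj₂ z) → C ≐ (↓ z)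
  ≐↓-of-maximal irreducible {z} max ¬line = C⊆↓z , ↓z⊆C
    where
    ↓Lines : Subset
    ↓Lines y = ∃[ s ] (LineIn C s × ∃[ k ] (y ≲ (k , s)))

    Ψ : Subset
    Ψ = ↓Maximal C (_≢ z) ∪ ↓Lines

    Ψ⊆C : Ψ ⊆ C
    Ψ⊆C y (inj₁ below)               = ↓Maximal⊆C y below
    Ψ⊆C _ (inj₂ (_ , line , k , y≲)) = lower y≲ (line k)

    Ψ-lower : LowerSet Ψ
    Ψ-lower y≲z (inj₁ below)               = inj₁ (↓Maximal-lower y≲z below)
    Ψ-lower y≲z (inj₂ (s , line , k , z≲)) = inj₂ (s , line , k , ≲-trans y≲z z≲)

    Ψ-chainClosed : ChainClosed Ψ
    Ψ-chainClosed m s chainΨ with em (Ψ (m , s))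
    ... | yes Ψms = Ψms
    ... | no ¬Ψms = ⊥-elim (¬Ψms (inj₂ (s , LineIn-of-cons cons-cover , m , ≲-refl)))
      where
      cons-cover : ∀ N → ∃[ b ] (N ≤ b × C (b , s)) ⊎ LineIn C (N ∷ s)
      cons-cover N with chainΨ N
      ... | inj₁ ((b , v) , maxg , g≢z , l) with ≲-cons⁻ l
      ...   | inj₁ p                    = ⊥-elim (¬Ψms (inj₁ ((b , v) , maxg , g≢z , p)))
      ...   | inj₂ (inj₁ (N≤b , p))     = inj₁ (b , N≤b , lower (≲-relevel b p) (proj₁ maxg))
      ...   | inj₂ (inj₂ (refl , N' , _ , refl)) =
        ⊥-elim (maximal⇒¬C-suc-head maxg (Ψ⊆C _ (chainΨ (suc N'))))
      cons-cover N | inj₂ (s' , line , k , l) with ≲-cons⁻ l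
      ...   | inj₁ p                    = ⊥-elim (¬Ψms (inj₂ (s' , line , k , p)))
      ...   | inj₂ (inj₁ (_ , p))       = ⊥-elim (¬Ψms (inj₂ (s' , line , m , p)))
      ...   | inj₂ (inj₂ (refl , _ , N≤N' , refl)) =
        inj₂ (λ b → lower (≲-level (∷≼∷ N≤N')) (line b))

    split : ∀ {g} → Maximal C g → (↓ z) g ⊎ g ≢ z
    split {g} _ with em (g ≡ z)
    ... | yes g≡z = inj₁ (inj₂ g≡z)
    ... | no g≢z  = inj₂ g≢z

    ¬Ψ : ¬ Ψ z
    ¬Ψ (inj₁ (_ , maxg , g≢z , z≲g)) = g≢z (proj₂ max (proj₁ maxg) z≲g)
    ¬Ψ (inj₂ (_ , line , k , z≲))   =
      ¬line (subst (LineIn C ∘ proj₂) (proj₂ max (line k) z≲) line)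

    C⊆↓z : C ⊆ (↓ z)
    C⊆↓z = irreducible-split irreducible (↓-scottClosed em z)
      (LowerSet∧ChainClosed⇒ScottClosed em Ψ-lower Ψ-chainClosed)
      (λ x Cx → map₂ inj₁ (maximal-cover (↓-lower z) split x Cx)) (proj₁ max) ¬Ψ

    ↓z⊆C : (↓ z) ⊆ C
    ↓z⊆C _ y⊑z = lower (⊑⇒≲ y⊑z) (proj₁ max)

theorem5p12 : ExcludedMiddle → (C : Subset) → ScottClosed C → Irreducible C →
    (∃[ x ] (C ≐ (↓ x))) ⊎ (∃[ s ] (C ≐ ↓L s))
theorem5p12 em C scC irreducible
  with em (∃[ z ] (Maximal C z × ¬ LineIn C (proj₂ z)))
... | yes (z , max , ¬line) = inj₁ (z , ≐↓-of-maximal em scC irreducible max ¬line)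
... | no none with maximal-above em scC (proj₂ (proj₁ irreducible))
...   | z , max , _ = inj₂ (proj₂ z , ≐↓L-of-maximal-lines em scC irreducible lines max)
  where
  open Classical em using (dne)
  lines : ∀ {z} → Maximal C z → LineIn C (proj₂ z)
  lines {z} maxz = dne (λ ¬line → none (z , maxz , ¬line))
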